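{- Let $p$ be a prime, $d\geq 2$ with $d\mid p-1$, $A,C\in\mathbb{F}_p$ with $A\neq 0$, $f(X)=AX^d+C$, and $\gamma\in\mathbb{F}_p$ a fixed primitive $d$-th root of unity. Let $r\geq 0$, $k\geq 1$, and let $\underline x=(x_1,\dots,x_k)\in\mathbb{F}_p^k$ satisfy $f^{\circ r}(x_1)=\dots=f^{\circ r}(x_k)$. For distinct $i,j$, if $x_i=x_j$ put $\ell(x_i,x_j)=-1$, $h(x_i,x_j)=0$; otherwise let $\ell(x_i,x_j)$ be the smallest $\ell\in\{0,\dots,r-1\}$ such that $f^{\circ\ell}(x_i)-\gamma^h f^{\circ\ell}(x_j)=0$ for some $1\leq h\leq d-1$, and let $h(x_i,x_j)$ be that (unique) $h$. Let $G_{\underline x}$ be the complete $(r-1,k,d)$-graph with $\xi_{G_{\underline x}}(a,b)=\ell(x_a,x_b)$ and $\eta_{G_{\underline x}}(a,b)=h(x_a,x_b)$ for every edge $\overline{ab}$. Then $G_{\underline x}$ is proper.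
   Context: Iterates: $f^{\circ 0}(X)=X$, $f^{\circ(j+1)}=f\circ f^{\circ j}$. An $(r,k,d)$-graph is a graph $G$ with vertex set $\{1,\dots,k\}$ together with, for each edge $\overline{ab}$, values $\xi_G(a,b),\xi_G(b,a)\in\{ -1,\dots,r\}$ and $\eta_G(a,b),\eta_G(b,a)\in\{0,\dots,d-1\}$ such that $\xi_G(a,b)=\xi_G(b,a)$, $\eta_G(a,b)+\eta_G(b,a)\equiv 0\pmod d$, $\eta=0$ when $\xi=-1$, and $\eta\in\{1,\dots,d-1\}$ when $\xi\geq 0$. Complete: every pair of distinct vertices is joined. Proper: for all distinct vertices $a,b,c$ with $\overline{ab},\overline{ac},\overline{bc}$ edges: (1) if $\xi_G(a,b)=\xi_G(b,c)=-1$ then $\xi_G(a,c)=-1$; (2) if $\xi_G(a,b)<\xi_G(b,c)$ then $\xi_G(a,c)=\xi_G(b,c)$ and $\eta_G(a,c)=\eta_G(b,c)$; (3) if $0\leq\xi_G(a,b)=\xi_G(b,c)$ and $\eta_G(a,b)+\eta_G(b,c)\neq d$ then $\xi_G(a,c)=\xi_G(a,b)$ and $\eta_G(a,c)\equiv\eta_G(a,b)+\eta_G(b,c)\pmod d$; (4) if $0\leq\xi_G(a,b)=\xi_G(b,c)$ and $\eta_G(a,b)+\eta_G(b,c)=d$ then $\xi_G(a,c)<\xi_G(a,b)$. -}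

module Defs where

open import Data.Nat using (ℕ; zero; suc; _+_; _*_; _∸_; _<_; _≤_; NonZero)
open import Data.Nat.DivMod using (_mod_)
open import Data.Nat.Divisibility using () renaming (_∣_ to _∣ℕ_)
open import Data.Integer as ℤ using (ℤ; +_; -[1+_]) renaming (_≤_ to _≤ℤ_; _<_ to _<ℤ_; _-_ to _-ℤ_; _+_ to _+ℤ_)
open import Data.Integer.Divisibility using () renaming (_∣_ to _∣ℤ_)
open import Data.Fin using (Fin; toℕ; _≟_)
open import Data.Bool using (Bool)
open import Data.List using (List; upTo; map; concatMap; findᵇ)
open import Data.Maybe using (Maybe; just; nothing)
open import Data.Product using (_×_; _,_)
open import Relation.Nullary using (¬_; does; yes; no)
open import Relation.Binary.PropositionalEquality using (_≡_; _≢_)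

iter : {A : Set} → (A → A) → ℕ → A → A
iter f zero x = x
iter f (suc j) x = f (iter f j x)

𝔽 : ℕ → Set
𝔽 p = Fin p

module _ (p : ℕ) .{{_ : NonZero p}} where
  zeroF : 𝔽 p
  zeroF = 0 mod p

  oneF : 𝔽 p
  oneF = 1 mod p

  addF : 𝔽 p → 𝔽 p → 𝔽 p
  addF a b = (toℕ a + toℕ b) mod p

  mulF : 𝔽 p → 𝔽 p → 𝔽 p
  mulF a b = (toℕ a * toℕ b) mod p

  powF : 𝔽 p → ℕ → 𝔽 p
  powF a zero = oneF
  powF a (suc n) = mulF a (powF a n)

  IsPrimitiveRoot : ℕ → 𝔽 p → Set
  IsPrimitiveRoot d γ = (powF γ d ≡ oneF) × (∀ j → 1 ≤ j → j < d → powF γ j ≢ oneF)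

  fpoly : (d : ℕ) (A C : 𝔽 p) → 𝔽 p → 𝔽 p
  fpoly d A C x = addF (mulF A (powF x d)) C

  candidates : ℕ → ℕ → List (ℕ × ℕ)
  candidates r d = concatMap (λ l → map (λ h → l , h) (map suc (upTo (d ∸ 1)))) (upTo r)

  -- If no (ℓ,h) exists (impossible under the hypotheses of the lemma),
  -- the default value (r , 0) is returned, which is not a valid edge label.
  ellh : (d : ℕ) (A C γ : 𝔽 p) (r : ℕ) → 𝔽 p → 𝔽 p → ℤ × ℕ
  ellh d A C γ r x y with does (x ≟ y)
  ... | Bool.true = -[1+ 0 ] , 0
  ... | Bool.false with findᵇ (λ lh → let (l , h) = lh in
                          does (iter (fpoly d A C) l x ≟ mulF (powF γ h) (iter (fpoly d A C) l y)))
                        (candidates r d)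
  ...   | just (l , h) = + l , h
  ...   | nothing = + r , 0

-- (r,k,d)-graph, complete: labels ξ, η on every pair of distinct vertices.
-- Here the parameter r is an integer (the lemma uses r-1, which may be -1).
IsCompleteGraph : (r : ℤ) (k d : ℕ) → (Fin k → Fin k → ℤ) → (Fin k → Fin k → ℕ) → Set
IsCompleteGraph r k d ξ η = ∀ a b → a ≢ b →
    (ξ a b ≡ ξ b a)
  × (-[1+ 0 ] ≤ℤ ξ a b) × (ξ a b ≤ℤ r)
  × (η a b < d)
  × (d ∣ℕ (η a b + η b a))
  × (ξ a b ≡ -[1+ 0 ] → η a b ≡ 0)
  × (+ 0 ≤ℤ ξ a b → 1 ≤ η a b)

IsProper : (k d : ℕ) → (Fin k → Fin k → ℤ) → (Fin k → Fin k → ℕ) → Set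
IsProper k d ξ η = ∀ a b c → a ≢ b → a ≢ c → b ≢ c →
    (ξ a b ≡ -[1+ 0 ] → ξ b c ≡ -[1+ 0 ] → ξ a c ≡ -[1+ 0 ])
  × (ξ a b <ℤ ξ b c → (ξ a c ≡ ξ b c) × (η a c ≡ η b c))
  × (+ 0 ≤ℤ ξ a b → ξ a b ≡ ξ b c → η a b + η b c ≢ d →
       (ξ a c ≡ ξ a b) × ((+ d) ∣ℤ (+ η a c -ℤ (+ η a b +ℤ + η b c))))
  × (+ 0 ≤ℤ ξ a b → ξ a b ≡ ξ b c → η a b + η b c ≡ d → ξ a c <ℤ ξ a b)

-- Since A ≠ 0, f u = f v holds exactly when u = γ^h v for some h < d: the d-th roots of
-- unity mod p are the powers of γ, because X^d − v^d has at most d roots. For v ≠ 0 this h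
-- is unique. Two distinct points whose r-th iterates agree therefore have a unique level
-- ℓ < r at which their orbits still differ but are related by a twist γ^h with h ≠ 0, and
-- coincide from ℓ + 1 on; (ℓ, h) is what ellh finds. Properness follows by composing
-- twists: a pair that coincides below the merge level of the next edge inherits that merge,
-- twists at a common level add their exponents mod d, and when γ^(h₁+h₂) = 1 the outer
-- pair already coincides at that level and so merged strictly earlier.

module Submission where

open import Defs
open import Data.Bool using (Bool; true; false; T)
open import Data.Empty using (⊥-elim)
open import Data.Fin using (Fin; toℕ)
import Data.Fin as Fin
import Data.Fin.Properties as Fin
open import Data.Integer using (ℤ; +_; -[1+_]; _-_)
import Data.Integer as ℤ
import Data.Integer.Properties as ℤ
import Data.Integer.Divisibility as ℤᵘ
import Data.Integer.Divisibility.Signed as Signed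
open import Data.List using (List; []; _∷_; _++_; _∷ʳ_; [_]; map; concatMap; upTo; findᵇ)
open import Data.List.Properties using (upTo-∷ʳ; concatMap-++)
open import Data.List.Membership.Propositional using (_∈_)
open import Data.List.Membership.Propositional.Properties using (∈-map⁺; ∈-map⁻; ∈-upTo⁺; ∈-upTo⁻)
open import Data.List.Relation.Unary.All using (All; []; _∷_; universal)
import Data.List.Relation.Unary.All.Properties as All
open import Data.List.Relation.Unary.Any using (here; there)
open import Data.Maybe using (just)
open import Data.Nat using (ℕ; zero; suc; _≤_; _<_; _∸_; NonZero; z≤n; s≤s)
import Data.Nat as ℕ
import Data.Nat.Properties as ℕ
open import Data.Nat.DivMod using (_mod_; _%_; _/_; %-remove-+ʳ; m≡m%n+[m/n]*n; m%n<n; m<n⇒m%n≡m; n%n≡0)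
open import Data.Nat.Divisibility using (_∣_; _∣0; m%n≡0⇒n∣m; n∣m⇒m%n≡0)
import Data.Nat.Divisibility as ℕ
open import Data.Nat.Primality using (Prime; euclidsLemma; prime⇒nonTrivial)
open import Data.Product using (∃; ∃₂; _×_; _,_; proj₁; proj₂)
import Data.Product as Product
open import Data.Sum using (_⊎_; inj₁; inj₂; [_,_]′)
import Data.Sum as Sum
open import Function using (_∘_; id)
open import Relation.Binary.Bundles using (Setoid)
open import Relation.Binary.PropositionalEquality using (_≡_; _≢_; refl; sym; trans; cong; cong₂; subst; module ≡-Reasoning)
import Relation.Binary.Reasoning.Setoid
open import Relation.Binary.Structures using (IsEquivalence)
open import Relation.Nullary using (¬_; Dec; yes; no; does; contradiction)
import Relation.Nullary.Decidable as Dec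

∣∧<⇒≡0 : ∀ {d n} .{{_ : NonZero d}} → d ∣ n → n < d → n ≡ 0
∣∧<⇒≡0 {d} {n} d∣n n<d = trans (sym (m<n⇒m%n≡m n<d)) (n∣m⇒m%n≡0 n d d∣n)

∣∧0<∧<2d⇒≡ : ∀ {d n} → d ∣ n → 1 ≤ n → n < d ℕ.+ d → n ≡ d
∣∧0<∧<2d⇒≡ {d} (ℕ.divides-refl zero) ()
∣∧0<∧<2d⇒≡ {d} (ℕ.divides-refl (suc zero)) _ _ = ℕ.+-identityʳ d
∣∧0<∧<2d⇒≡ {d} (ℕ.divides-refl (suc (suc q))) _ n<2d =
  contradiction (ℕ.+-monoʳ-≤ d (ℕ.m≤m+n d (q ℕ.* d))) (ℕ.<⇒≱ n<2d)

module _ where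

  open import Data.Integer using (_+_; _*_; -_; _^_)
  open import Data.Integer.Tactic.RingSolver using (solve-∀)

  d∣[n%d]-n : ∀ n d .{{_ : NonZero d}} → + d Signed.∣ + (n % d) - + n
  d∣[n%d]-n n d = Signed.divides (- + (n / d)) (begin
    + (n % d) - + n                           ≡⟨ cong (λ t → + (n % d) - t) +n≡ ⟩
    + (n % d) - (+ (n % d) + + (n / d) * + d) ≡⟨ cancel (+ (n % d)) (+ (n / d)) (+ d) ⟩
    - + (n / d) * + d                         ∎)
    where
    open ≡-Reasoning
    +n≡ : + n ≡ + (n % d) + + (n / d) * + d
    +n≡ = trans (cong +_ (m≡m%n+[m/n]*n n d)) (trans (ℤ.pos-+ (n % d) _) (cong (λ t → + (n % d) + t) (ℤ.pos-* (n / d) d)))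
    cancel : ∀ r q d → r - (r + q * d) ≡ - q * d
    cancel = solve-∀

  ^-distribʳ-* : ∀ x y n → (x * y) ^ n ≡ x ^ n * y ^ n
  ^-distribʳ-* x y zero    = refl
  ^-distribʳ-* x y (suc n) = trans (cong ((x * y) *_) (^-distribʳ-* x y n)) (interchange x y (x ^ n) (y ^ n))
    where
    interchange : ∀ a b c e → (a * b) * (c * e) ≡ (a * c) * (b * e)
    interchange = solve-∀

module _ {A : Set} (P : A → Bool) where

  findᵇ-++-none : ∀ {xs} ys → All (λ z → ¬ T (P z)) xs → findᵇ P (xs ++ ys) ≡ findᵇ P ys
  findᵇ-++-none ys [] = refl
  findᵇ-++-none {x ∷ _} ys (¬Px ∷ ¬Pxs) with P x
  ... | true  = contradiction _ ¬Px
  ... | false = findᵇ-++-none ys ¬Pxs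

  findᵇ-++-just : ∀ xs ys {z} → findᵇ P xs ≡ just z → findᵇ P (xs ++ ys) ≡ just z
  findᵇ-++-just (x ∷ xs) ys found with P x
  ... | true  = found
  ... | false = findᵇ-++-just xs ys found

  findᵇ-unique : ∀ {xs z} → z ∈ xs → T (P z) → (∀ {w} → w ∈ xs → T (P w) → w ≡ z) → findᵇ P xs ≡ just z
  findᵇ-unique {x ∷ _} z∈ Pz unique with P x in Px
  ... | true = cong just (unique (here refl) (subst T (sym Px) _))
  ... | false with z∈
  ...   | here refl  = ⊥-elim (subst T Px Pz)
  ...   | there z∈xs = findᵇ-unique z∈xs Pz (unique ∘ there)

  findᵇ-concatMap-upTo : ∀ (g : ℕ → List A) {L n z} → L < n → (∀ {l} → l < L → All (λ w → ¬ T (P w)) (g l)) →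
                         findᵇ P (g L) ≡ just z → findᵇ P (concatMap g (upTo n)) ≡ just z
  findᵇ-concatMap-upTo g {L} {suc n} {z} L<1+n earlier found = begin
    findᵇ P (concatMap g (upTo (suc n)))           ≡⟨ cong (findᵇ P ∘ concatMap g) (upTo-∷ʳ n) ⟨
    findᵇ P (concatMap g (upTo n ∷ʳ n))            ≡⟨ cong (findᵇ P) (concatMap-++ g (upTo n) [ n ]) ⟩
    findᵇ P (concatMap g (upTo n) ++ (g n ++ []))  ≡⟨ last-block (ℕ.m<1+n⇒m<n∨m≡n L<1+n) ⟩
    just z                                          ∎
    where
    open ≡-Reasoning
    last-block : L < n ⊎ L ≡ n → findᵇ P (concatMap g (upTo n) ++ (g n ++ [])) ≡ just z
    last-block (inj₁ L<n) = findᵇ-++-just (concatMap g (upTo n)) (g n ++ []) (findᵇ-concatMap-upTo g L<n earlier found)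
    last-block (inj₂ refl) =
      trans (findᵇ-++-none {concatMap g (upTo n)} (g n ++ []) (All.concat⁺ (All.map⁺ (All.applyUpTo⁺₁ id n earlier))))
                                   (findᵇ-++-just (g n) [] found)

module Congruence (p : ℕ) .{{_ : NonZero p}} (p-prime : Prime p) where

  open import Data.Integer using (_+_; _*_; -_; _^_; ∣_∣)
  open import Data.Integer.Divisibility.Signed
    using (divides; ∣m∣n⇒∣m+n; ∣m⇒∣-m; ∣n⇒∣m*n; ∣m⇒∣m*n; ∣⇒∣ᵤ; ∣ᵤ⇒∣)
    renaming (_∣_ to _∣ℤ_; _∣?_ to _∣ℤ?_)
  open import Data.Integer.Tactic.RingSolver using (solve-∀)

  infix 4 _≈_ _≉_
  record _≈_ (x y : ℤ) : Set where
    constructor mk≈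
    field p∣x-y : + p ∣ℤ x - y

  _≉_ : ℤ → ℤ → Set
  x ≉ y = ¬ x ≈ y

  private
    via : ∀ {z u v} → z ≡ u - v → + p ∣ℤ z → u ≈ v
    via eq h = mk≈ (subst (+ p ∣ℤ_) eq h)

  ≈-isEquivalence : IsEquivalence _≈_
  ≈-isEquivalence = record
    { refl  = λ {x} → via (sym (ℤ.+-inverseʳ x)) (divides (+ 0) refl)
    ; sym   = λ {x} {y} (mk≈ h) → via (neg-sub x y) (∣m⇒∣-m h)
    ; trans = λ {x} {y} {z} (mk≈ h) (mk≈ k) → via (sub-trans x y z) (∣m∣n⇒∣m+n h k)
    }
    where
    neg-sub : ∀ x y → - (x - y) ≡ y - x
    neg-sub = solve-∀
    sub-trans : ∀ x y z → (x - y) + (y - z) ≡ x - z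
    sub-trans = solve-∀

  ≈-setoid : Setoid _ _
  ≈-setoid = record { isEquivalence = ≈-isEquivalence }

  module ≈-Reasoning = Relation.Binary.Reasoning.Setoid ≈-setoid

  open IsEquivalence ≈-isEquivalence public
    using () renaming (refl to ≈-refl; sym to ≈-sym; trans to ≈-trans; reflexive to ≈-reflexive)

  +-cong : ∀ {x y u v} → x ≈ y → u ≈ v → x + u ≈ y + v
  +-cong {x} {y} {u} {v} (mk≈ h) (mk≈ k) = via (sub-+ x y u v) (∣m∣n⇒∣m+n h k)
    where
    sub-+ : ∀ x y u v → (x - y) + (u - v) ≡ (x + u) - (y + v)
    sub-+ = solve-∀

  *-cong : ∀ {x y u v} → x ≈ y → u ≈ v → x * u ≈ y * v
  *-cong {x} {y} {u} {v} (mk≈ h) (mk≈ k) = via (sub-* x y u v) (∣m∣n⇒∣m+n (∣m⇒∣m*n u h) (∣n⇒∣m*n y k))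
    where
    sub-* : ∀ x y u v → (x - y) * u + y * (u - v) ≡ x * u - y * v
    sub-* = solve-∀

  ^-cong : ∀ {x y} n → x ≈ y → x ^ n ≈ y ^ n
  ^-cong zero    _   = ≈-refl
  ^-cong (suc n) x≈y = *-cong x≈y (^-cong n x≈y)

  affine-cong : ∀ a c {x y} → x ≈ y → a * x + c ≈ a * y + c
  affine-cong a c x≈y = +-cong (*-cong (≈-refl {a}) x≈y) (≈-refl {c})

  ≈0⇒p∣ : ∀ {x} → x ≈ + 0 → + p ∣ℤ x
  ≈0⇒p∣ {x} (mk≈ h) = subst (+ p ∣ℤ_) (ℤ.+-identityʳ x) h

  p∣⇒≈0 : ∀ {x} → + p ∣ℤ x → x ≈ + 0
  p∣⇒≈0 {x} h = mk≈ (subst (+ p ∣ℤ_) (sym (ℤ.+-identityʳ x)) h)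

  _≈0? : ∀ x → Dec (x ≈ + 0)
  x ≈0? = Dec.map′ p∣⇒≈0 ≈0⇒p∣ (+ p ∣ℤ? x)

  -≈0⇒≈ : ∀ {x y} → x - y ≈ + 0 → x ≈ y
  -≈0⇒≈ = mk≈ ∘ ≈0⇒p∣

  ≈⇒-≈0 : ∀ {x y} → x ≈ y → x - y ≈ + 0
  ≈⇒-≈0 (mk≈ h) = p∣⇒≈0 h

  +-cancelʳ-≈ : ∀ {c x y} → x + c ≈ y + c → x ≈ y
  +-cancelʳ-≈ {c} {x} {y} x+c≈y+c = begin
    x             ≡⟨ undo x c ⟩
    (x + c) - c   ≈⟨ +-cong x+c≈y+c (≈-refl { - c}) ⟩
    (y + c) - c   ≡⟨ undo y c ⟨
    y             ∎
    where
    open ≈-Reasoning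
    undo : ∀ x c → x ≡ (x + c) - c
    undo = solve-∀

  1≉0 : + 1 ≉ + 0
  1≉0 1≈0 =
    ℕ.<⇒≢ (ℕ.nonTrivial⇒n>1 p {{prime⇒nonTrivial p-prime}}) (sym (ℕ.∣1⇒≡1 (∣⇒∣ᵤ (≈0⇒p∣ 1≈0))))

  x*y≈0⇒x≈0⊎y≈0 : ∀ {x y} → x * y ≈ + 0 → x ≈ + 0 ⊎ y ≈ + 0
  x*y≈0⇒x≈0⊎y≈0 {x} {y} xy≈0 = Sum.map (p∣⇒≈0 ∘ ∣ᵤ⇒∣) (p∣⇒≈0 ∘ ∣ᵤ⇒∣)
    (euclidsLemma ∣ x ∣ ∣ y ∣ p-prime (subst (p ∣_) (ℤ.abs-* x y) (∣⇒∣ᵤ (≈0⇒p∣ xy≈0))))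

  x^n≈0⇒x≈0 : ∀ {x} n → x ^ n ≈ + 0 → x ≈ + 0
  x^n≈0⇒x≈0 zero    1≈0   = ⊥-elim (1≉0 1≈0)
  x^n≈0⇒x≈0 (suc n) x^n≈0 = [ id , x^n≈0⇒x≈0 n ]′ (x*y≈0⇒x≈0⊎y≈0 x^n≈0)

  x≈0⇒x^n≈0 : ∀ {x} n .{{_ : NonZero n}} → x ≈ + 0 → x ^ n ≈ + 0
  x≈0⇒x^n≈0 {x} (suc n) x≈0 = ≈-trans (*-cong x≈0 (≈-refl {x ^ n})) (≈-reflexive (ℤ.*-zeroˡ (x ^ n)))

  *-cancelˡ-≈ : ∀ {c x y} → c ≉ + 0 → c * x ≈ c * y → x ≈ y
  *-cancelˡ-≈ {c} {x} {y} c≉0 cx≈cy = [ ⊥-elim ∘ c≉0 , -≈0⇒≈ ]′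
    (x*y≈0⇒x≈0⊎y≈0 (≈-trans (≈-reflexive (factor c x y)) (≈⇒-≈0 cx≈cy)))
    where
    factor : ∀ c x y → c * (x - y) ≡ c * x - c * y
    factor = solve-∀

  *-cancelʳ-≈ : ∀ {c x y} → c ≉ + 0 → x * c ≈ y * c → x ≈ y
  *-cancelʳ-≈ {c} {x} {y} c≉0 xc≈yc =
    *-cancelˡ-≈ c≉0 (≈-trans (≈-reflexive (ℤ.*-comm c x)) (≈-trans xc≈yc (≈-reflexive (ℤ.*-comm y c))))

  +≈+⇒p∣∸ : ∀ {m n} → m ≤ n → + m ≈ + n → p ∣ n ∸ m
  +≈+⇒p∣∸ {m} {n} m≤n (mk≈ p∣m-n) =
    subst (p ∣_) (trans (cong ∣_∣ (ℤ.m-n≡m⊖n m n)) (ℤ.∣⊖∣-≤ m≤n)) (∣⇒∣ᵤ p∣m-n)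

  +≈+⇒%≡ : ∀ {m n} → + m ≈ + n → m % p ≡ n % p
  +≈+⇒%≡ {m} {n} m≈n =
    [ (λ m≤n → sym (shift m≤n m≈n)) , (λ n≤m → shift n≤m (≈-sym m≈n)) ]′ (ℕ.≤-total m n)
    where
    shift : ∀ {m n} → m ≤ n → + m ≈ + n → n % p ≡ m % p
    shift {m} {n} m≤n m≈n = begin
      n % p               ≡⟨ cong (_% p) (ℕ.m+[n∸m]≡n m≤n) ⟨
      (m ℕ.+ (n ∸ m)) % p ≡⟨ %-remove-+ʳ m (+≈+⇒p∣∸ m≤n m≈n) ⟩
      m % p               ∎
      where open ≡-Reasoning

  +[n%p]≈+n : ∀ n → + (n % p) ≈ + n
  +[n%p]≈+n n = mk≈ (d∣[n%d]-n n p)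

module MonicPolynomial (p : ℕ) .{{_ : NonZero p}} (p-prime : Prime p) where

  open Congruence p p-prime
  open import Data.Integer using (_+_; _*_; -_; _^_)
  open import Data.Integer.Tactic.RingSolver using (solve-∀)

  infixl 5 _·X+_
  data Monic : ℕ → Set where
    1ₘ    : Monic 0
    _·X+_ : ∀ {n} → Monic n → ℤ → Monic (suc n)

  eval : ∀ {n} → Monic n → ℤ → ℤ
  eval 1ₘ        x = + 1
  eval (P ·X+ c) x = eval P x * x + c

  factor-theorem : ∀ {n} (P : Monic (suc n)) a →
                   ∃ λ (Q : Monic n) → ∀ x → eval P x ≡ (x - a) * eval Q x + eval P a
  factor-theorem (1ₘ ·X+ c) a = 1ₘ , λ x → linear x c a
    where
    linear : ∀ x c a → + 1 * x + c ≡ (x - a) * + 1 + (+ 1 * a + c)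
    linear = solve-∀
  factor-theorem ((P ·X+ c′) ·X+ c) a =
    let Q , P≡ = factor-theorem (P ·X+ c′) a
    in (Q ·X+ eval (P ·X+ c′) a) , λ x → trans (cong (λ t → t * x + c) (P≡ x)) (horner x a (eval Q x) _ c)
    where
    horner : ∀ x a q r c → ((x - a) * q + r) * x + c ≡ (x - a) * (q * x + r) + (r * a + c)
    horner = solve-∀

  factor-root : ∀ {n} (P : Monic (suc n)) {a} → eval P a ≈ + 0 →
                ∃ λ (Q : Monic n) → ∀ {y} → eval P y ≈ + 0 → y ≈ a ⊎ eval Q y ≈ + 0
  factor-root P {a} Pa≈0 = Q , λ {y} Py≈0 → Sum.map -≈0⇒≈ id (x*y≈0⇒x≈0⊎y≈0 (begin
      (y - a) * eval Q y              ≡⟨ ℤ.+-identityʳ ((y - a) * eval Q y) ⟨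
      (y - a) * eval Q y + + 0        ≈⟨ +-cong (≈-refl {(y - a) * eval Q y}) Pa≈0 ⟨
      (y - a) * eval Q y + eval P a   ≡⟨ P≡ y ⟨
      eval P y                        ≈⟨ Py≈0 ⟩
      + 0                             ∎))
    where
    open ≈-Reasoning
    Q = proj₁ (factor-theorem P a)
    P≡ = proj₂ (factor-theorem P a)

  roots-bound : ∀ {n} (P : Monic n) (g : Fin n → ℤ) → (∀ i → eval P (g i) ≈ + 0) →
                (∀ {i j} → g i ≈ g j → i ≡ j) → ∀ {z} → eval P z ≈ + 0 → ∃ λ i → z ≈ g i
  roots-bound 1ₘ _ _ _ 1≈0 = ⊥-elim (1≉0 1≈0)
  roots-bound P@(_ ·X+ _) g roots injective Pz≈0 =
    [ (λ z≈g₀ → Fin.zero , z≈g₀)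
    , (λ Qz≈0 → Product.map Fin.suc id (roots-bound Q (g ∘ Fin.suc) Q-roots (Fin.suc-injective ∘ injective) Qz≈0))
    ]′ (split Pz≈0)
    where
    Q = proj₁ (factor-root P (roots Fin.zero))
    split = proj₂ (factor-root P (roots Fin.zero))
    Q-roots : ∀ i → eval Q (g (Fin.suc i)) ≈ + 0
    Q-roots i = [ (λ gᵢ≈g₀ → contradiction (sym (injective gᵢ≈g₀)) Fin.0≢1+n) , id ]′ (split (roots (Fin.suc i)))

  monomial : ∀ n → Monic n
  monomial zero    = 1ₘ
  monomial (suc n) = monomial n ·X+ + 0

  eval-monomial : ∀ n x → eval (monomial n) x ≡ x ^ n
  eval-monomial zero    x = refl
  eval-monomial (suc n) x = begin
    eval (monomial n) x * x + + 0 ≡⟨ ℤ.+-identityʳ _ ⟩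
    eval (monomial n) x * x       ≡⟨ cong (_* x) (eval-monomial n x) ⟩
    x ^ n * x                     ≡⟨ ℤ.*-comm (x ^ n) x ⟩
    x ^ suc n                     ∎
    where open ≡-Reasoning

  infix 5 X^_-_
  X^_-_ : ∀ n .{{_ : NonZero n}} → ℤ → Monic n
  X^ suc n - c = monomial n ·X+ (- c)

  eval-X^- : ∀ n .{{_ : NonZero n}} c x → eval (X^ n - c) x ≡ x ^ n - c
  eval-X^- (suc n) c x = cong (_- c) (trans (cong (_* x) (eval-monomial n x)) (ℤ.*-comm (x ^ n) x))

module RootOfUnity (p : ℕ) .{{_ : NonZero p}} (p-prime : Prime p)
                   (d : ℕ) .{{_ : NonZero d}} (g : ℤ) (g^d≈1 : Congruence._≈_ p p-prime (g ℤ.^ d) (+ 1))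
                   (g^j≉1 : ∀ j → 1 ≤ j → j < d → Congruence._≉_ p p-prime (g ℤ.^ j) (+ 1)) where

  open Congruence p p-prime
  open MonicPolynomial p p-prime
  open import Data.Integer using (_*_; _^_)
  open ≈-Reasoning

  g^n≉0 : ∀ n → g ^ n ≉ + 0
  g^n≉0 n g^n≈0 = 1≉0 (≈-trans (≈-sym g^d≈1) (x≈0⇒x^n≈0 d (x^n≈0⇒x≈0 n g^n≈0)))

  g^[d*q]≈1 : ∀ q → g ^ (d ℕ.* q) ≈ + 1
  g^[d*q]≈1 q = begin
    g ^ (d ℕ.* q) ≡⟨ ℤ.^-*-assoc g d q ⟨
    (g ^ d) ^ q   ≈⟨ ^-cong q g^d≈1 ⟩
    (+ 1) ^ q     ≡⟨ ℤ.^-zeroˡ q ⟩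
    + 1           ∎

  g^n≈g^[n%d] : ∀ n → g ^ n ≈ g ^ (n % d)
  g^n≈g^[n%d] n = begin
    g ^ n                                  ≡⟨ cong (g ^_) (m≡m%n+[m/n]*n n d) ⟩
    g ^ (n % d ℕ.+ n / d ℕ.* d)            ≡⟨ ℤ.^-distribˡ-+-* g (n % d) (n / d ℕ.* d) ⟩
    g ^ (n % d) * g ^ (n / d ℕ.* d)        ≡⟨ cong (λ t → g ^ (n % d) * g ^ t) (ℕ.*-comm (n / d) d) ⟩
    g ^ (n % d) * g ^ (d ℕ.* (n / d))      ≈⟨ *-cong (≈-refl {g ^ (n % d)}) (g^[d*q]≈1 (n / d)) ⟩
    g ^ (n % d) * + 1                      ≡⟨ ℤ.*-identityʳ (g ^ (n % d)) ⟩
    g ^ (n % d)                            ∎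

  g^n≈1⇒d∣n : ∀ n → g ^ n ≈ + 1 → d ∣ n
  g^n≈1⇒d∣n n g^n≈1 with n % d in n%d≡
  ... | zero  = m%n≡0⇒n∣m n d n%d≡
  ... | suc j = contradiction g^[1+j]≈1 (g^j≉1 (suc j) (s≤s z≤n) (subst (_< d) n%d≡ (m%n<n n d)))
    where
    g^[1+j]≈1 : g ^ suc j ≈ + 1
    g^[1+j]≈1 = subst (λ t → g ^ t ≈ + 1) n%d≡ (≈-trans (≈-sym (g^n≈g^[n%d] n)) g^n≈1)

  g^n*v≈v⇒d∣n : ∀ {n v} → v ≉ + 0 → g ^ n * v ≈ v → d ∣ n
  g^n*v≈v⇒d∣n {n} {v} v≉0 g^n*v≈v =
    g^n≈1⇒d∣n n (*-cancelʳ-≈ v≉0 (≈-trans g^n*v≈v (≈-reflexive (sym (ℤ.*-identityˡ v)))))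

  g^n*v≉0 : ∀ n {v} → v ≉ + 0 → g ^ n * v ≉ + 0
  g^n*v≉0 n v≉0 g^n*v≈0 = [ g^n≉0 n , v≉0 ]′ (x*y≈0⇒x≈0⊎y≈0 g^n*v≈0)

  g^j*v≈g^i*v⇒j≡i : ∀ {i j v} → v ≉ + 0 → i ≤ j → j < d → g ^ j * v ≈ g ^ i * v → j ≡ i
  g^j*v≈g^i*v⇒j≡i {i} {j} {v} v≉0 i≤j j<d g^j*v≈g^i*v =
    ℕ.≤-antisym (ℕ.m∸n≡0⇒m≤n (∣∧<⇒≡0 d∣j∸i (ℕ.≤-<-trans (ℕ.m∸n≤m j i) j<d))) i≤j
    where
    d∣j∸i : d ∣ j ∸ i
    d∣j∸i = g^n*v≈v⇒d∣n (g^n*v≉0 i v≉0) (begin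
      g ^ (j ∸ i) * (g ^ i * v) ≡⟨ ℤ.*-assoc (g ^ (j ∸ i)) (g ^ i) v ⟨
      g ^ (j ∸ i) * g ^ i * v   ≡⟨ cong (_* v) (ℤ.^-distribˡ-+-* g (j ∸ i) i) ⟨
      g ^ (j ∸ i ℕ.+ i) * v     ≡⟨ cong (λ t → g ^ t * v) (ℕ.m∸n+n≡m i≤j) ⟩
      g ^ j * v                 ≈⟨ g^j*v≈g^i*v ⟩
      g ^ i * v                 ∎)

  g^i*v≈g^j*v⇒i≡j : ∀ {i j v} → v ≉ + 0 → i < d → j < d → g ^ i * v ≈ g ^ j * v → i ≡ j
  g^i*v≈g^j*v⇒i≡j {i} {j} v≉0 i<d j<d eq =
    [ (λ i≤j → sym (g^j*v≈g^i*v⇒j≡i v≉0 i≤j j<d (≈-sym eq)))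
    , (λ j≤i → g^j*v≈g^i*v⇒j≡i v≉0 j≤i i<d eq)
    ]′ (ℕ.≤-total i j)

  [g^h*v]^d≈v^d : ∀ h v → (g ^ h * v) ^ d ≈ v ^ d
  [g^h*v]^d≈v^d h v = begin
    (g ^ h * v) ^ d     ≡⟨ ^-distribʳ-* (g ^ h) v d ⟩
    (g ^ h) ^ d * v ^ d ≡⟨ cong (_* v ^ d) (trans (ℤ.^-*-assoc g h d) (cong (g ^_) (ℕ.*-comm h d))) ⟩
    g ^ (d ℕ.* h) * v ^ d ≈⟨ *-cong (g^[d*q]≈1 h) (≈-refl {v ^ d}) ⟩
    + 1 * v ^ d         ≡⟨ ℤ.*-identityˡ (v ^ d) ⟩
    v ^ d               ∎

  dth-roots : ∀ {u v} → u ^ d ≈ v ^ d → ∃ λ h → h < d × u ≈ g ^ h * v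
  dth-roots {u} {v} u^d≈v^d with v ≈0?
  ... | yes v≈0 = 0 , ℕ.>-nonZero⁻¹ d , (begin
    u         ≈⟨ x^n≈0⇒x≈0 d (≈-trans u^d≈v^d (x≈0⇒x^n≈0 d v≈0)) ⟩
    + 0       ≈⟨ ≈-sym v≈0 ⟩
    v         ≡⟨ ℤ.*-identityˡ v ⟨
    + 1 * v   ∎)
  ... | no v≉0 = Product.map toℕ (λ {i} u≈gⁱv → Fin.toℕ<n i , u≈gⁱv)
                   (roots-bound (X^ d - v ^ d) root roots injective u-root)
    where
    root : Fin d → ℤ
    root i = g ^ toℕ i * v
    roots : ∀ i → eval (X^ d - v ^ d) (root i) ≈ + 0
    roots i = ≈-trans (≈-reflexive (eval-X^- d (v ^ d) (root i))) (≈⇒-≈0 ([g^h*v]^d≈v^d (toℕ i) v))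
    injective : ∀ {i j} → root i ≈ root j → i ≡ j
    injective {i} {j} = Fin.toℕ-injective ∘ g^i*v≈g^j*v⇒i≡j v≉0 (Fin.toℕ<n i) (Fin.toℕ<n j)
    u-root : eval (X^ d - v ^ d) u ≈ + 0
    u-root = ≈-trans (≈-reflexive (eval-X^- d (v ^ d) u)) (≈⇒-≈0 u^d≈v^d)


-- Defs models 𝔽 p as Fin p with every operation reduced mod p; ⟦_⟧ carries these operations
-- to ℤ modulo p, where the ring laws are available.
module Residues (p : ℕ) .{{_ : NonZero p}} (p-prime : Prime p) where

  open Congruence p p-prime
  open import Data.Integer using (_+_; _*_; _^_)

  ⟦_⟧ : 𝔽 p → ℤ
  ⟦ a ⟧ = + toℕ a

  ⟦⟧-injective : ∀ {a b} → ⟦ a ⟧ ≈ ⟦ b ⟧ → a ≡ b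
  ⟦⟧-injective {a} {b} ⟦a⟧≈⟦b⟧ = Fin.toℕ-injective (begin
    toℕ a     ≡⟨ m<n⇒m%n≡m (Fin.toℕ<n a) ⟨
    toℕ a % p ≡⟨ +≈+⇒%≡ ⟦a⟧≈⟦b⟧ ⟩
    toℕ b % p ≡⟨ m<n⇒m%n≡m (Fin.toℕ<n b) ⟩
    toℕ b     ∎)
    where open ≡-Reasoning

  ⟦mod⟧ : ∀ n → ⟦ n mod p ⟧ ≈ + n
  ⟦mod⟧ n = subst (λ t → + t ≈ + n) (sym (Fin.toℕ-fromℕ< (m%n<n n p))) (+[n%p]≈+n n)

  ⟦zeroF⟧ : ⟦ zeroF p ⟧ ≈ + 0
  ⟦zeroF⟧ = ⟦mod⟧ 0

  ⟦oneF⟧ : ⟦ oneF p ⟧ ≈ + 1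
  ⟦oneF⟧ = ⟦mod⟧ 1

  ≢zeroF⇒≉0 : ∀ {a} → a ≢ zeroF p → ⟦ a ⟧ ≉ + 0
  ≢zeroF⇒≉0 a≢0 ⟦a⟧≈0 = a≢0 (⟦⟧-injective (≈-trans ⟦a⟧≈0 (≈-sym ⟦zeroF⟧)))

  ⟦addF⟧ : ∀ a b → ⟦ addF p a b ⟧ ≈ ⟦ a ⟧ + ⟦ b ⟧
  ⟦addF⟧ a b = ≈-trans (⟦mod⟧ (toℕ a ℕ.+ toℕ b)) (≈-reflexive (ℤ.pos-+ (toℕ a) (toℕ b)))

  ⟦mulF⟧ : ∀ a b → ⟦ mulF p a b ⟧ ≈ ⟦ a ⟧ * ⟦ b ⟧
  ⟦mulF⟧ a b = ≈-trans (⟦mod⟧ (toℕ a ℕ.* toℕ b)) (≈-reflexive (ℤ.pos-* (toℕ a) (toℕ b)))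

  ⟦powF⟧ : ∀ a n → ⟦ powF p a n ⟧ ≈ ⟦ a ⟧ ^ n
  ⟦powF⟧ a zero    = ⟦oneF⟧
  ⟦powF⟧ a (suc n) = ≈-trans (⟦mulF⟧ a (powF p a n)) (*-cong (≈-refl {⟦ a ⟧}) (⟦powF⟧ a n))

  ⟦fpoly⟧ : ∀ d A C x → ⟦ fpoly p d A C x ⟧ ≈ ⟦ A ⟧ * ⟦ x ⟧ ^ d + ⟦ C ⟧
  ⟦fpoly⟧ d A C x = begin
    ⟦ addF p (mulF p A (powF p x d)) C ⟧    ≈⟨ ⟦addF⟧ (mulF p A (powF p x d)) C ⟩
    ⟦ mulF p A (powF p x d) ⟧ + ⟦ C ⟧      ≈⟨ +-cong (⟦mulF⟧ A (powF p x d)) (≈-refl {⟦ C ⟧}) ⟩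
    ⟦ A ⟧ * ⟦ powF p x d ⟧ + ⟦ C ⟧        ≈⟨ affine-cong ⟦ A ⟧ ⟦ C ⟧ (⟦powF⟧ x d) ⟩
    ⟦ A ⟧ * ⟦ x ⟧ ^ d + ⟦ C ⟧             ∎
    where open ≈-Reasoning

module PowerMap (p : ℕ) .{{_ : NonZero p}} (p-prime : Prime p)
                (d : ℕ) .{{_ : NonZero d}} (A C γ : 𝔽 p)
                (A≢0 : A ≢ zeroF p) (γ-primitive : IsPrimitiveRoot p d γ) where

  open Congruence p p-prime
  open Residues p p-prime
  open import Data.Integer using (_+_; _*_; _^_)

  f : 𝔽 p → 𝔽 p
  f = fpoly p d A C

  rotate : ℕ → 𝔽 p → 𝔽 p
  rotate h w = mulF p (powF p γ h) w

  ⟦γ⟧^d≈1 : ⟦ γ ⟧ ^ d ≈ + 1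
  ⟦γ⟧^d≈1 = ≈-trans (≈-sym (⟦powF⟧ γ d)) (≈-trans (≈-reflexive (cong ⟦_⟧ (proj₁ γ-primitive))) ⟦oneF⟧)

  ⟦γ⟧^j≉1 : ∀ j → 1 ≤ j → j < d → ⟦ γ ⟧ ^ j ≉ + 1
  ⟦γ⟧^j≉1 j 1≤j j<d ⟦γ⟧^j≈1 =
    proj₂ γ-primitive j 1≤j j<d (⟦⟧-injective (≈-trans (⟦powF⟧ γ j) (≈-trans ⟦γ⟧^j≈1 (≈-sym ⟦oneF⟧))))

  open RootOfUnity p p-prime d ⟦ γ ⟧ ⟦γ⟧^d≈1 ⟦γ⟧^j≉1

  ⟦rotate⟧ : ∀ h w → ⟦ rotate h w ⟧ ≈ ⟦ γ ⟧ ^ h * ⟦ w ⟧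
  ⟦rotate⟧ h w = ≈-trans (⟦mulF⟧ (powF p γ h) w) (*-cong (⟦powF⟧ γ h) (≈-refl {⟦ w ⟧}))

  rotate-zero : ∀ w → rotate 0 w ≡ w
  rotate-zero w = ⟦⟧-injective (≈-trans (⟦rotate⟧ 0 w) (≈-reflexive (ℤ.*-identityˡ ⟦ w ⟧)))

  rotate-+ : ∀ h h′ w → rotate h (rotate h′ w) ≡ rotate (h ℕ.+ h′) w
  rotate-+ h h′ w = ⟦⟧-injective (begin
    ⟦ rotate h (rotate h′ w) ⟧         ≈⟨ ⟦rotate⟧ h (rotate h′ w) ⟩
    ⟦ γ ⟧ ^ h * ⟦ rotate h′ w ⟧         ≈⟨ *-cong (≈-refl {⟦ γ ⟧ ^ h}) (⟦rotate⟧ h′ w) ⟩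
    ⟦ γ ⟧ ^ h * (⟦ γ ⟧ ^ h′ * ⟦ w ⟧)   ≡⟨ ℤ.*-assoc (⟦ γ ⟧ ^ h) (⟦ γ ⟧ ^ h′) ⟦ w ⟧ ⟨
    ⟦ γ ⟧ ^ h * ⟦ γ ⟧ ^ h′ * ⟦ w ⟧     ≡⟨ cong (_* ⟦ w ⟧) (ℤ.^-distribˡ-+-* ⟦ γ ⟧ h h′) ⟨
    ⟦ γ ⟧ ^ (h ℕ.+ h′) * ⟦ w ⟧         ≈⟨ ⟦rotate⟧ (h ℕ.+ h′) w ⟨
    ⟦ rotate (h ℕ.+ h′) w ⟧            ∎)
    where open ≈-Reasoning

  rotate-% : ∀ n w → rotate n w ≡ rotate (n % d) w
  rotate-% n w = ⟦⟧-injective (begin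
    ⟦ rotate n w ⟧               ≈⟨ ⟦rotate⟧ n w ⟩
    ⟦ γ ⟧ ^ n * ⟦ w ⟧            ≈⟨ *-cong (g^n≈g^[n%d] n) (≈-refl {⟦ w ⟧}) ⟩
    ⟦ γ ⟧ ^ (n % d) * ⟦ w ⟧      ≈⟨ ⟦rotate⟧ (n % d) w ⟨
    ⟦ rotate (n % d) w ⟧         ∎)
    where open ≈-Reasoning

  rotate-d : ∀ w → rotate d w ≡ w
  rotate-d w = trans (rotate-% d w) (trans (cong (λ t → rotate t w) (n%n≡0 d)) (rotate-zero w))

  rotate-zeroF : ∀ h → rotate h (zeroF p) ≡ zeroF p
  rotate-zeroF h = ⟦⟧-injective (begin
    ⟦ rotate h (zeroF p) ⟧        ≈⟨ ⟦rotate⟧ h (zeroF p) ⟩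
    ⟦ γ ⟧ ^ h * ⟦ zeroF p ⟧       ≈⟨ *-cong (≈-refl {⟦ γ ⟧ ^ h}) ⟦zeroF⟧ ⟩
    ⟦ γ ⟧ ^ h * + 0               ≡⟨ ℤ.*-zeroʳ (⟦ γ ⟧ ^ h) ⟩
    + 0                           ≈⟨ ⟦zeroF⟧ ⟨
    ⟦ zeroF p ⟧                   ∎)
    where open ≈-Reasoning

  rotate-fixed⇒d∣ : ∀ {n w} → w ≢ zeroF p → rotate n w ≡ w → d ∣ n
  rotate-fixed⇒d∣ {n} {w} w≢0 fixed =
    g^n*v≈v⇒d∣n (≢zeroF⇒≉0 w≢0) (≈-trans (≈-sym (⟦rotate⟧ n w)) (≈-reflexive (cong ⟦_⟧ fixed)))

  rotate-injective : ∀ {h h′ w} → w ≢ zeroF p → h < d → h′ < d → rotate h w ≡ rotate h′ w → h ≡ h′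
  rotate-injective {h} {h′} {w} w≢0 h<d h′<d eq = g^i*v≈g^j*v⇒i≡j (≢zeroF⇒≉0 w≢0) h<d h′<d
    (≈-trans (≈-sym (⟦rotate⟧ h w)) (≈-trans (≈-reflexive (cong ⟦_⟧ eq)) (⟦rotate⟧ h′ w)))

  f-rotate : ∀ h w → f (rotate h w) ≡ f w
  f-rotate h w = ⟦⟧-injective (begin
    ⟦ f (rotate h w) ⟧                         ≈⟨ ⟦fpoly⟧ d A C (rotate h w) ⟩
    ⟦ A ⟧ * ⟦ rotate h w ⟧ ^ d + ⟦ C ⟧          ≈⟨ affine-cong ⟦ A ⟧ ⟦ C ⟧ (^-cong d (⟦rotate⟧ h w)) ⟩
    ⟦ A ⟧ * (⟦ γ ⟧ ^ h * ⟦ w ⟧) ^ d + ⟦ C ⟧    ≈⟨ affine-cong ⟦ A ⟧ ⟦ C ⟧ ([g^h*v]^d≈v^d h ⟦ w ⟧) ⟩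
    ⟦ A ⟧ * ⟦ w ⟧ ^ d + ⟦ C ⟧                   ≈⟨ ⟦fpoly⟧ d A C w ⟨
    ⟦ f w ⟧                                    ∎)
    where open ≈-Reasoning

  f-fibre : ∀ {u v} → f u ≡ f v → ∃ λ h → h < d × u ≡ rotate h v
  f-fibre {u} {v} fu≡fv =
    let h , h<d , ⟦u⟧≈ = dth-roots ⟦u⟧^d≈⟦v⟧^d
    in h , h<d , ⟦⟧-injective (≈-trans ⟦u⟧≈ (≈-sym (⟦rotate⟧ h v)))
    where
    ⟦u⟧^d≈⟦v⟧^d : ⟦ u ⟧ ^ d ≈ ⟦ v ⟧ ^ d
    ⟦u⟧^d≈⟦v⟧^d = *-cancelˡ-≈ (≢zeroF⇒≉0 A≢0) (+-cancelʳ-≈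
      (≈-trans (≈-sym (⟦fpoly⟧ d A C u)) (≈-trans (≈-reflexive (cong ⟦_⟧ fu≡fv)) (⟦fpoly⟧ d A C v))))

module OrbitGraph (p : ℕ) .{{_ : NonZero p}} (p-prime : Prime p)
                  (d : ℕ) .{{_ : NonZero d}} (A C γ : 𝔽 p)
                  (A≢0 : A ≢ zeroF p) (γ-primitive : IsPrimitiveRoot p d γ) (r : ℕ) where

  open PowerMap p p-prime d A C γ A≢0 γ-primitive

  twisted? : 𝔽 p → 𝔽 p → ℕ × ℕ → Bool
  twisted? x y (l , h) = does (iter f l x Fin.≟ rotate h (iter f l y))

  twisted?-sound : ∀ {x y l h} → T (twisted? x y (l , h)) → iter f l x ≡ rotate h (iter f l y)
  twisted?-sound {x} {y} {l} {h} twisted with iter f l x Fin.≟ rotate h (iter f l y)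
  ... | yes e = e

  twisted?-complete : ∀ {x y l h} → iter f l x ≡ rotate h (iter f l y) → T (twisted? x y (l , h))
  twisted?-complete {x} {y} {l} {h} e with iter f l x Fin.≟ rotate h (iter f l y)
  ... | yes _  = _
  ... | no ¬e = ¬e e

  agree-mono : ∀ {x y m n} → m ≤ n → iter f m x ≡ iter f m y → iter f n x ≡ iter f n y
  agree-mono {x} {y} {m} m≤n agree = go (ℕ.≤⇒≤′ m≤n)
    where
    go : ∀ {n} → m ℕ.≤′ n → iter f n x ≡ iter f n y
    go ℕ.≤′-refl        = agree
    go (ℕ.≤′-step m≤′n) = cong f (go m≤′n)

  -- In the paper's notation, MergeAt x y L h says ℓ(x, y) = L and h(x, y) = h.
  record MergeAt (x y : 𝔽 p) (L h : ℕ) : Set where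
    field
      apart : iter f L x ≢ iter f L y
      twist : iter f L x ≡ rotate h (iter f L y)
      h<d   : h < d

    distinct : x ≢ y
    distinct = apart ∘ cong (iter f L)

    meet : iter f (suc L) x ≡ iter f (suc L) y
    meet = trans (cong f twist) (f-rotate h (iter f L y))

    1≤h : 1 ≤ h
    1≤h = ℕ.n≢0⇒n>0 λ { refl → apart (trans twist (rotate-zero (iter f L y))) }

    target≢0 : iter f L y ≢ zeroF p
    target≢0 y≡0 = apart (trans twist (trans (cong (rotate h) y≡0) (trans (rotate-zeroF h) (sym y≡0))))

    before : ∀ {m} → iter f m x ≡ iter f m y → L < m
    before agree = ℕ.≰⇒> (λ m≤L → apart (agree-mono m≤L agree))

  open MergeAt

  mergeAt-level-unique : ∀ {x y L h L′ h′} → MergeAt x y L h → MergeAt x y L′ h′ → L ≡ L′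
  mergeAt-level-unique M M′ = ℕ.≤-antisym (ℕ.s≤s⁻¹ (before M (meet M′))) (ℕ.s≤s⁻¹ (before M′ (meet M)))

  mergeAt-twist-unique : ∀ {x y L h h′} → MergeAt x y L h → MergeAt x y L h′ → h ≡ h′
  mergeAt-twist-unique M M′ = rotate-injective (target≢0 M) (h<d M) (h<d M′) (trans (sym (twist M)) (twist M′))

  mergeAt-unique : ∀ {x y L h L′ h′} → MergeAt x y L h → MergeAt x y L′ h′ → L ≡ L′ × h ≡ h′
  mergeAt-unique {x} {y} {h′ = h′} M M′ =
    L≡L′ , mergeAt-twist-unique M (subst (λ l → MergeAt x y l h′) (sym L≡L′) M′)
    where
    L≡L′ = mergeAt-level-unique M M′

  mergeAt-exists : ∀ {x y} n → x ≢ y → iter f n x ≡ iter f n y → ∃₂ λ L h → L < n × MergeAt x y L h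
  mergeAt-exists zero x≢y x≡y = contradiction x≡y x≢y
  mergeAt-exists {x} {y} (suc n) x≢y agree = extend (iter f n x Fin.≟ iter f n y)
    where
    extend : Dec (iter f n x ≡ iter f n y) → ∃₂ λ L h → L < suc n × MergeAt x y L h
    extend (yes agreeₙ) = let L , h , L<n , M = mergeAt-exists n x≢y agreeₙ in L , h , ℕ.m≤n⇒m≤1+n L<n , M
    extend (no apartₙ)  = let h , h<d , twistₙ = f-fibre agree in
      n , h , ℕ.n<1+n n , record { apart = apartₙ ; twist = twistₙ ; h<d = h<d }

  mergeAt-sym : ∀ {x y L h} → MergeAt x y L h → MergeAt y x L (d ∸ h)
  mergeAt-sym {x} {y} {L} {h} M = record
    { apart = apart M ∘ sym
    ; twist = sym (begin
        rotate (d ∸ h) (iter f L x)            ≡⟨ cong (rotate (d ∸ h)) (twist M) ⟩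
        rotate (d ∸ h) (rotate h (iter f L y)) ≡⟨ rotate-+ (d ∸ h) h (iter f L y) ⟩
        rotate (d ∸ h ℕ.+ h) (iter f L y)      ≡⟨ cong (λ t → rotate t (iter f L y)) (ℕ.m∸n+n≡m (ℕ.<⇒≤ (h<d M))) ⟩
        rotate d (iter f L y)                  ≡⟨ rotate-d (iter f L y) ⟩
        iter f L y                             ∎)
    ; h<d = ℕ.∸-monoʳ-< (1≤h M) (ℕ.<⇒≤ (h<d M))
    }
    where open ≡-Reasoning

  mergeAt-respˡ : ∀ {u v w L h} → iter f L u ≡ iter f L v → MergeAt v w L h → MergeAt u w L h
  mergeAt-respˡ u≡v M = record { apart = apart M ∘ trans (sym u≡v) ; twist = trans u≡v (twist M) ; h<d = h<d M }

  mergeAt-compose : ∀ {u v w L h h′} → MergeAt u v L h → MergeAt v w L h′ →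
                    iter f L u ≡ rotate (h ℕ.+ h′) (iter f L w)
  mergeAt-compose {u} {v} {w} {L} {h} {h′} M M′ = begin
    iter f L u                               ≡⟨ twist M ⟩
    rotate h (iter f L v)                    ≡⟨ cong (rotate h) (twist M′) ⟩
    rotate h (rotate h′ (iter f L w))        ≡⟨ rotate-+ h h′ (iter f L w) ⟩
    rotate (h ℕ.+ h′) (iter f L w)           ∎
    where open ≡-Reasoning

  mergeAt-compose-% : ∀ {u v w L h h′} → MergeAt u v L h → MergeAt v w L h′ → h ℕ.+ h′ ≢ d →
                      MergeAt u w L ((h ℕ.+ h′) % d)
  mergeAt-compose-% {u} {v} {w} {L} {h} {h′} M M′ h+h′≢d = record
    { apart = λ agree → h+h′≢d (∣∧0<∧<2d⇒≡
        (rotate-fixed⇒d∣ (target≢0 M′) (trans (sym (mergeAt-compose M M′)) agree))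
        (ℕ.≤-trans (1≤h M) (ℕ.m≤m+n h h′)) (ℕ.+-mono-< (h<d M) (h<d M′)))
    ; twist = trans (mergeAt-compose M M′) (rotate-% (h ℕ.+ h′) (iter f L w))
    ; h<d   = m%n<n (h ℕ.+ h′) d
    }

  mergeAt-compose-d : ∀ {u v w L h h′} → MergeAt u v L h → MergeAt v w L h′ → h ℕ.+ h′ ≡ d →
                      iter f L u ≡ iter f L w
  mergeAt-compose-d {w = w} {L} M M′ h+h′≡d =
    trans (mergeAt-compose M M′) (trans (cong (λ t → rotate t (iter f L w)) h+h′≡d) (rotate-d (iter f L w)))

  block : ℕ → List (ℕ × ℕ)
  block l = map (l ,_) (map suc (upTo (d ∸ 1)))

  ∈-block⁺ : ∀ {l h} → 1 ≤ h → h < d → (l , h) ∈ block l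
  ∈-block⁺ {l} {suc k} _ 1+k<d = ∈-map⁺ (l ,_) (∈-map⁺ suc (∈-upTo⁺ (pred-< 1+k<d)))
    where
    pred-< : ∀ {m n} → suc m < n → m < n ∸ 1
    pred-< {n = suc n} (s≤s m<n) = m<n

  ∈-block⁻ : ∀ {l w} → w ∈ block l → ∃ λ h → w ≡ (l , h) × h < d
  ∈-block⁻ {l} w∈ with ∈-map⁻ (l ,_) w∈
  ... | h , h∈ , refl with ∈-map⁻ suc h∈
  ...   | k , k∈ , refl = suc k , refl , suc-< (∈-upTo⁻ k∈)
    where
    suc-< : ∀ {m n} → m < n ∸ 1 → suc m < n
    suc-< {n = zero}  ()
    suc-< {n = suc n} m<n = s≤s m<n

  -- Below L every test fails, since a twist at level l would
  -- make the orbits agree at l + 1 ≤ L; at level L only h passes. (The implicit arguments of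
  -- twisted?-sound/complete are explicit because inferring them unfolds the mod-p arithmetic.)
  find-first-merge : ∀ {x y L h} → L < r → MergeAt x y L h →
                     findᵇ (twisted? x y) (candidates p r d) ≡ just (L , h)
  find-first-merge {x} {y} {L} {h} L<r M = findᵇ-concatMap-upTo (twisted? x y) block L<r earlier in-block
    where
    earlier : ∀ {l} → l < L → All (λ w → ¬ T (twisted? x y w)) (block l)
    earlier {l} l<L = All.map⁺ (universal (λ h′ twisted → apart M (agree-mono l<L (begin
      iter f (suc l) x                 ≡⟨ cong f (twisted?-sound {x} {y} {l} {h′} twisted) ⟩
      f (rotate h′ (iter f l y))       ≡⟨ f-rotate h′ (iter f l y) ⟩
      iter f (suc l) y                 ∎))) _)
      where open ≡-Reasoning
    only-h : ∀ {w} → w ∈ block L → T (twisted? x y w) → w ≡ (L , h)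
    only-h {w} w∈ twisted =
      let h′ , w≡ , h′<d = ∈-block⁻ w∈
          twist′ = twisted?-sound {x} {y} {L} {h′} (subst (T ∘ twisted? x y) w≡ twisted)
      in trans w≡ (cong (L ,_) (rotate-injective (target≢0 M) h′<d (h<d M) (trans (sym twist′) (twist M))))
    in-block : findᵇ (twisted? x y) (block L) ≡ just (L , h)
    in-block = findᵇ-unique (twisted? x y) (∈-block⁺ (1≤h M) (h<d M))
                 (twisted?-complete {x} {y} {L} {h} (twist M)) only-h

  ellh-≡ : ∀ {x y} → x ≡ y → ellh p d A C γ r x y ≡ (-[1+ 0 ] , 0)
  ellh-≡ {x} {y} x≡y with x Fin.≟ y
  ... | yes _   = refl
  ... | no x≢y = contradiction x≡y x≢y

  ellh-found : ∀ {x y L h} → x ≢ y → findᵇ (twisted? x y) (candidates p r d) ≡ just (L , h) →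
               ellh p d A C γ r x y ≡ (+ L , h)
  ellh-found {x} {y} x≢y found with x Fin.≟ y
  ... | yes x≡y = contradiction x≡y x≢y
  ... | no _ rewrite found = refl

  ellh-mergeAt : ∀ {x y L h} → L < r → MergeAt x y L h → ellh p d A C γ r x y ≡ (+ L , h)
  ellh-mergeAt L<r M = ellh-found (distinct M) (find-first-merge L<r M)

  data Label (x y : 𝔽 p) : ℤ × ℕ → Set where
    equal  : x ≡ y → Label x y (-[1+ 0 ] , 0)
    merged : ∀ {L h} → L < r → MergeAt x y L h → Label x y (+ L , h)

  label : ∀ {x y} → iter f r x ≡ iter f r y → Label x y (ellh p d A C γ r x y)
  label {x} {y} agree = classify (x Fin.≟ y)
    where
    classify : Dec (x ≡ y) → Label x y (ellh p d A C γ r x y)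
    classify (yes x≡y) = subst (Label x y) (sym (ellh-≡ x≡y)) (equal x≡y)
    classify (no x≢y)  = let L , h , L<r , M = mergeAt-exists r x≢y agree in
      subst (Label x y) (sym (ellh-mergeAt L<r M)) (merged L<r M)

  Label-≡ : ∀ {u w e} → u ≡ w → Label u w e → proj₁ e ≡ -[1+ 0 ]
  Label-≡ _   (equal _)    = refl
  Label-≡ u≡w (merged _ M) = contradiction u≡w (distinct M)

  Label-mergeAt : ∀ {u w e L h} → Label u w e → MergeAt u w L h → e ≡ (+ L , h)
  Label-mergeAt (equal u≡w)   M  = contradiction u≡w (distinct M)
  Label-mergeAt (merged _ M′) M  = let L′≡L , h′≡h = mergeAt-unique M′ M in cong₂ _,_ (cong +_ L′≡L) h′≡h

  edge-labels : ∀ {u v e e′} → Label u v e → Label v u e′ →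
      (proj₁ e ≡ proj₁ e′) × (-[1+ 0 ] ℤ.≤ proj₁ e) × (proj₁ e ℤ.≤ + r - + 1) × (proj₂ e < d)
      × (d ∣ proj₂ e ℕ.+ proj₂ e′) × (proj₁ e ≡ -[1+ 0 ] → proj₂ e ≡ 0)
      × (+ 0 ℤ.≤ proj₁ e → 1 ≤ proj₂ e)
  edge-labels (equal _) (equal _) =
    refl , ℤ.≤-refl , -1≤r-1 r , ℕ.>-nonZero⁻¹ d , d ∣0 , (λ _ → refl) , λ ()
    where
    -1≤r-1 : ∀ r → -[1+ 0 ] ℤ.≤ + r - + 1
    -1≤r-1 zero    = ℤ.≤-refl
    -1≤r-1 (suc r) = ℤ.-≤+
  edge-labels (equal u≡v)  (merged _ M) = contradiction (sym u≡v) (distinct M)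
  edge-labels (merged _ M) (equal v≡u)  = contradiction (sym v≡u) (distinct M)
  edge-labels {e′ = _ , h′} (merged {h = h} L<r M) (merged _ M′) =
    let L≡L′ , d∸h≡h′ = mergeAt-unique (mergeAt-sym M) M′ in
    cong +_ L≡L′ , ℤ.-≤+ , below-r L<r , h<d M
    , subst (λ t → d ∣ h ℕ.+ t) d∸h≡h′ (subst (d ∣_) (sym (ℕ.m+[n∸m]≡n (ℕ.<⇒≤ (h<d M)))) ℕ.∣-refl)
    , (λ ()) , λ _ → 1≤h M
    where
    below-r : ∀ {L r} → L < r → + L ℤ.≤ + r - + 1
    below-r {r = suc r} (s≤s L≤r) = ℤ.+≤+ L≤r

  triangle-unmerged : ∀ {u v w e₁ e₂ e₃} → Label u v e₁ → Label v w e₂ → Label u w e₃ →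
                      proj₁ e₁ ≡ -[1+ 0 ] → proj₁ e₂ ≡ -[1+ 0 ] → proj₁ e₃ ≡ -[1+ 0 ]
  triangle-unmerged (equal u≡v) (equal v≡w) uw _ _ = Label-≡ (trans u≡v v≡w) uw
  triangle-unmerged (equal _) (merged _ _) _ _ ()
  triangle-unmerged (merged _ _) _ _ ()

  triangle-later : ∀ {u v w e₁ e₂ e₃} → Label u v e₁ → Label v w e₂ → Label u w e₃ →
                   proj₁ e₁ ℤ.< proj₁ e₂ → (proj₁ e₃ ≡ proj₁ e₂) × (proj₂ e₃ ≡ proj₂ e₂)
  triangle-later (equal _)    (equal _)    _  (ℤ.-<- ())
  triangle-later (merged _ _) (equal _)    _  ()
  triangle-later (equal u≡v)  (merged _ M) uw _ =
    Product.< cong proj₁ , cong proj₂ > (Label-mergeAt uw (subst (λ t → MergeAt t _ _ _) (sym u≡v) M))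
  triangle-later (merged _ M₁) (merged _ M₂) uw (ℤ.+<+ L₁<L₂) =
    Product.< cong proj₁ , cong proj₂ > (Label-mergeAt uw (mergeAt-respˡ (agree-mono L₁<L₂ (meet M₁)) M₂))

  triangle-same-level : ∀ {u v w e₁ e₂ e₃} → Label u v e₁ → Label v w e₂ → Label u w e₃ →
                        + 0 ℤ.≤ proj₁ e₁ → proj₁ e₁ ≡ proj₁ e₂ → proj₂ e₁ ℕ.+ proj₂ e₂ ≢ d →
                        (proj₁ e₃ ≡ proj₁ e₁) × (+ d ℤᵘ.∣ + proj₂ e₃ - (+ proj₂ e₁ ℤ.+ + proj₂ e₂))
  triangle-same-level (equal _) _ _ ()
  triangle-same-level (merged _ _) (equal _) _ _ ()
  triangle-same-level (merged {h = h₁} _ M₁) (merged {h = h₂} _ M₂) uw _ refl h₁+h₂≢d =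
    let e₃≡ = Label-mergeAt uw (mergeAt-compose-% M₁ M₂ h₁+h₂≢d) in
    cong proj₁ e₃≡ ,
    subst (λ t → + d ℤᵘ.∣ + t - + (h₁ ℕ.+ h₂)) (sym (cong proj₂ e₃≡))
      (Signed.∣⇒∣ᵤ (d∣[n%d]-n (h₁ ℕ.+ h₂) d))

  triangle-cancelling : ∀ {u v w e₁ e₂ e₃} → Label u v e₁ → Label v w e₂ → Label u w e₃ →
                        + 0 ℤ.≤ proj₁ e₁ → proj₁ e₁ ≡ proj₁ e₂ → proj₂ e₁ ℕ.+ proj₂ e₂ ≡ d →
                        proj₁ e₃ ℤ.< proj₁ e₁
  triangle-cancelling (equal _) _ _ ()
  triangle-cancelling (merged _ _) (equal _) _ _ ()
  triangle-cancelling (merged _ _)  (merged _ _)  (equal _)     _ refl _      = ℤ.-<+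
  triangle-cancelling (merged _ M₁) (merged _ M₂) (merged _ M₃) _ refl h₁+h₂≡d =
    ℤ.+<+ (before M₃ (mergeAt-compose-d M₁ M₂ h₁+h₂≡d))

lemma2p7 : (p : ℕ) .{{_ : NonZero p}} → Prime p →
    (d : ℕ) → 2 ≤ d → d ∣ (p ∸ 1) →
    (A C : 𝔽 p) → A ≢ zeroF p →
    (γ : 𝔽 p) → IsPrimitiveRoot p d γ →
    (r k : ℕ) → 1 ≤ k → (x : Fin k → 𝔽 p) →
    (∀ i j → iter (fpoly p d A C) r (x i) ≡ iter (fpoly p d A C) r (x j)) →
    IsCompleteGraph (+ r - + 1) k d (λ a b → proj₁ (ellh p d A C γ r (x a) (x b))) (λ a b → proj₂ (ellh p d A C γ r (x a) (x b)))
    × IsProper k d (λ a b → proj₁ (ellh p d A C γ r (x a) (x b))) (λ a b → proj₂ (ellh p d A C γ r (x a) (x b)))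
lemma2p7 p p-prime d 2≤d _ A C A≢0 γ γ-primitive r k _ x orbits-agree =
  (λ a b _ → edge-labels (lab a b) (lab b a)) ,
  λ a b c _ _ _ →
    triangle-unmerged (lab a b) (lab b c) (lab a c) ,
    triangle-later (lab a b) (lab b c) (lab a c) ,
    triangle-same-level (lab a b) (lab b c) (lab a c) ,
    triangle-cancelling (lab a b) (lab b c) (lab a c)
  where
  instance
    d≢0 : NonZero d
    d≢0 = ℕ.>-nonZero (ℕ.≤-trans (s≤s z≤n) 2≤d)
  open OrbitGraph p p-prime d A C γ A≢0 γ-primitive r
  lab : ∀ a b → Label (x a) (x b) (ellh p d A C γ r (x a) (x b))
  lab a b = label (orbits-agree a b)
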